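{- Let $q$ be a prime power, $t$ a positive integer, and $\mathbb K$ the algebraic closure of $\mathbb F_q$, viewed as an $\mathbb F_q$-vector space. Let $a\in\mathbb K\setminus\{0\}$, and for $B=(b_1,\ldots,b_t)\in\mathbb K^t$ let \[ f_{a,B}(x)=a^q x+b_1x^q+\cdots+b_t x^{q^t}+(-1)^{t+1}a\,x^{q^{t+1}}\in\mathbb K[x]. \] Let $\mathcal B_a=\{\ker f_{a,B}\mid B\in\mathbb K^t\}$, where $\ker f_{a,B}$ is the set of roots of $f_{a,B}$ in $\mathbb K$. Then every $t$-dimensional $\mathbb F_q$-subspace of $\mathbb K$ is contained in some element of $\mathcal B_a$.
   Context: All vector spaces are $\mathbb F_q$-subspaces of $\mathbb K$. -}

module Defs where

open import Level using (Level; _⊔_) renaming (suc to lsuc)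
open import Data.Nat using (ℕ; zero; suc; _≥_) renaming (_^_ to _^ℕ_)
open import Data.Nat.Primality using (Prime)
open import Data.Fin using (Fin; zero; suc; toℕ)
open import Data.List using (List; []; _∷_; length)
open import Data.List.Relation.Unary.All using (All)
open import Data.Product using (Σ; _×_; _,_)
open import Relation.Nullary using (¬_)
open import Relation.Binary.PropositionalEquality using (_≡_)
open import Algebra.Bundles using (CommutativeRing)

module _ {c ℓ : Level} (K : CommutativeRing c ℓ) where
  open CommutativeRing K using (Carrier; _≈_; _+_; _*_; -_; 0#; 1#)

  pow : Carrier → ℕ → Carrier
  pow x zero    = 1#
  pow x (suc n) = x * pow x n

  natK : ℕ → Carrier
  natK zero    = 0#
  natK (suc n) = 1# + natK n

  sumFin : (t : ℕ) → (Fin t → Carrier) → Carrier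
  sumFin zero    f = 0#
  sumFin (suc t) f = f zero + sumFin t (λ i → f (suc i))

  IsField : Set (c ⊔ ℓ)
  IsField = (¬ (1# ≈ 0#)) × (∀ x → ¬ (x ≈ 0#) → Σ Carrier λ y → x * y ≈ 1#)

  -- Polynomials as coefficient lists [c₀, c₁, …, cₙ] (constant term first);
  -- evaluation by Horner's rule.
  eval : List Carrier → Carrier → Carrier
  eval []       x = 0#
  eval (a ∷ cs) x = a + x * eval cs x

  -- the monic polynomial c₀ + c₁x + … + c_{n-1}x^{n-1} + xⁿ from [c₀,…,c_{n-1}]
  monic : List Carrier → List Carrier
  monic []       = 1# ∷ []
  monic (a ∷ cs) = a ∷ monic cs

  AlgClosed : Set (c ⊔ ℓ)
  AlgClosed = ∀ (cs : List Carrier) → length cs ≥ 1 →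
              Σ Carrier λ r → eval (monic cs) r ≈ 0#

  -- membership in the subfield F_q = {x ∈ K | x^q = x}
  InFq : ℕ → Carrier → Set ℓ
  InFq q x = pow x q ≈ x

  IsAlgClosureOfFq : ℕ → Set (c ⊔ ℓ)
  IsAlgClosureOfFq q =
    Σ ℕ λ p → Σ ℕ λ n →
      Prime p × n ≥ 1 × q ≡ p ^ℕ n ×
      IsField × natK p ≈ 0# × AlgClosed ×
      (∀ x → Σ (List Carrier) λ cs → All (InFq q) cs × eval (monic cs) x ≈ 0#)

  record IsFqSubspace {u : Level} (q : ℕ) (U : Carrier → Set u) : Set (c ⊔ ℓ ⊔ u) where
    field
      respects : ∀ {x y} → x ≈ y → U x → U y
      zero∈    : U 0#
      +-closed : ∀ {x y} → U x → U y → U (x + y)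
      ·-closed : ∀ {λ′ x} → InFq q λ′ → U x → U (λ′ * x)

  linComb : (t : ℕ) → (Fin t → Carrier) → (Fin t → Carrier) → Carrier
  linComb t cs us = sumFin t (λ i → cs i * us i)

  FqIndependent : ℕ → (t : ℕ) → (Fin t → Carrier) → Set (c ⊔ ℓ)
  FqIndependent q t us = ∀ (cs : Fin t → Carrier) → (∀ i → InFq q (cs i)) →
                         linComb t cs us ≈ 0# → ∀ i → cs i ≈ 0#

  InFqSpan : ℕ → (t : ℕ) → (Fin t → Carrier) → Carrier → Set (c ⊔ ℓ)
  InFqSpan q t us x = Σ (Fin t → Carrier) λ cs → (∀ i → InFq q (cs i)) × x ≈ linComb t cs us

  HasFqDim : {u : Level} → ℕ → (Carrier → Set u) → ℕ → Set (c ⊔ ℓ ⊔ u)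
  HasFqDim q U t = Σ (Fin t → Carrier) λ us →
                   FqIndependent q t us ×
                   (∀ x → (U x → InFqSpan q t us x) × (InFqSpan q t us x → U x))

  -- f_{a,B}(x) = a^q x + b₁ x^q + … + b_t x^{q^t} + (-1)^{t+1} a x^{q^{t+1}}
  -- (B i  for i : Fin t  is  b_{i+1})
  fab : (q t : ℕ) → Carrier → (Fin t → Carrier) → Carrier → Carrier
  fab q t a B x =
    pow a q * x
    + sumFin t (λ i → B i * pow x (q ^ℕ suc (toℕ i)))
    + pow (- 1#) (suc t) * a * pow x (q ^ℕ suc t)

{-# OPTIONS --safe #-}
-- Since q is a power of the characteristic, φ(x) = x^q is additive, so each q-polynomial
-- Σ lᵢ x^(q^i) is an F_q-linear map. For an F_q-basis u₁, …, u_t of U, the subspace polynomial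
-- L = (x^q − w^(q−1) x) ∘ L′, with L′ the one of u₂, …, u_t and w = L′(u₁), is monic of q-degree t
-- and vanishes on U. Its x-coefficient ℓ₀ is nonzero, since a q-polynomial of q-degree < m that
-- vanishes on m independent elements is zero (this also gives w ≠ 0). Hence
-- f = (−1)^(t+1) a L(x)^q + (a^q / ℓ₀) L(x) has the shape of f_{a,B} and vanishes on U.
module Submission where

open import Defs
open import Level using (Level)
open import Data.Nat as ℕ using (ℕ; zero; suc; _≥_; _≤_; _<_; s≤s; z≤n)
open import Data.Fin using (Fin; zero; suc; toℕ; fromℕ; inject₁)
open import Data.Product using (Σ; _,_; proj₁; proj₂)
open import Relation.Nullary using (¬_)
open import Relation.Binary.PropositionalEquality as ≡ using (_≡_)
open import Algebra.Bundles using (CommutativeRing)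
open import Data.Nat.Primality using (Prime)

module _ where
  open import Data.Nat using (_+_; _*_; z<s; s<s)
  open import Data.Nat.Properties
    using (+-assoc; *-comm; *-identityˡ; *-identityʳ; *-zeroʳ; *-distribˡ-+; <⇒≱)
  open import Data.Nat.Combinatorics using (_C_; k>n⇒nCk≡0; nC1≡n; nCk+nC[k+1]≡[n+1]C[k+1])
  open import Data.Nat.Divisibility using (_∣_; divides; ∣⇒≤)
  open import Data.Nat.Primality using (euclidsLemma)
  open import Data.Sum using (inj₁; inj₂)
  open import Data.Empty using (⊥-elim)
  open ≡ using (refl; sym; trans; cong; cong₂)
  open ≡.≡-Reasoning

  [k+1]*[n+1]C[k+1]≡[n+1]*nCk : ∀ n k → suc k * (suc n C suc k) ≡ suc n * (n C k)
  [k+1]*[n+1]C[k+1]≡[n+1]*nCk zero zero = refl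
  [k+1]*[n+1]C[k+1]≡[n+1]*nCk zero (suc k)
    rewrite k>n⇒nCk≡0 {1} {suc (suc k)} (s<s z<s) | k>n⇒nCk≡0 {0} {suc k} z<s
    = *-zeroʳ (suc (suc k))
  [k+1]*[n+1]C[k+1]≡[n+1]*nCk (suc n) zero =
    trans (*-identityˡ _) (trans (nC1≡n (suc (suc n))) (sym (*-identityʳ _)))
  [k+1]*[n+1]C[k+1]≡[n+1]*nCk (suc n) (suc k) = begin
    suc (suc k) * (suc (suc n) C suc (suc k))
      ≡⟨ cong (suc (suc k) *_) (nCk+nC[k+1]≡[n+1]C[k+1] (suc n) (suc k)) ⟨
    suc (suc k) * (A + B)
      ≡⟨ *-distribˡ-+ (suc (suc k)) A B ⟩
    (A + suc k * A) + suc (suc k) * B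
      ≡⟨ cong₂ (λ u v → (A + u) + v) ([k+1]*[n+1]C[k+1]≡[n+1]*nCk n k)
                                     ([k+1]*[n+1]C[k+1]≡[n+1]*nCk n (suc k)) ⟩
    (A + suc n * (n C k)) + suc n * (n C suc k)
      ≡⟨ +-assoc A _ _ ⟩
    A + (suc n * (n C k) + suc n * (n C suc k))
      ≡⟨ cong (A +_) (*-distribˡ-+ (suc n) (n C k) (n C suc k)) ⟨
    A + suc n * (n C k + n C suc k)
      ≡⟨ cong (λ u → A + suc n * u) (nCk+nC[k+1]≡[n+1]C[k+1] n k) ⟩
    suc (suc n) * A ∎
    where
    A = suc n C suc k
    B = suc n C suc (suc k)

  p∣pCk : ∀ {p k} → Prime p → 0 < k → k < p → p ∣ p C k
  p∣pCk {suc n} {suc k} p-prime _ k<p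
    with euclidsLemma (suc k) (suc n C suc k) p-prime
           (divides (n C k) (trans ([k+1]*[n+1]C[k+1]≡[n+1]*nCk n k) (*-comm (suc n) (n C k))))
  ... | inj₁ p∣k+1 = ⊥-elim (<⇒≱ k<p (∣⇒≤ p∣k+1))
  ... | inj₂ p∣pCk = p∣pCk

module Powers {c ℓ : Level} (K : CommutativeRing c ℓ) where
  open CommutativeRing K hiding (zero)
  open import Relation.Binary.Reasoning.Setoid setoid
  open import Algebra.Properties.Semiring.Exp semiring using (_^_; ^-congˡ; ^-assocʳ)
  open import Algebra.Properties.CommutativeSemiring.Exp commutativeSemiring using (^-distrib-*)

  pow≈^ : ∀ x n → pow K x n ≈ x ^ n
  pow≈^ x zero    = refl
  pow≈^ x (suc n) = *-congˡ (pow≈^ x n)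

  pow-congˡ : ∀ n {x y} → x ≈ y → pow K x n ≈ pow K y n
  pow-congˡ n {x} {y} x≈y = begin
    pow K x n ≈⟨ pow≈^ x n ⟩
    x ^ n     ≈⟨ ^-congˡ n x≈y ⟩
    y ^ n     ≈⟨ pow≈^ y n ⟨
    pow K y n ∎

  pow-assocʳ : ∀ x m n → pow K (pow K x m) n ≈ pow K x (m ℕ.* n)
  pow-assocʳ x m n = begin
    pow K (pow K x m) n ≈⟨ pow≈^ (pow K x m) n ⟩
    pow K x m ^ n       ≈⟨ ^-congˡ n (pow≈^ x m) ⟩
    (x ^ m) ^ n         ≈⟨ ^-assocʳ x m n ⟩
    x ^ (m ℕ.* n)       ≈⟨ pow≈^ x (m ℕ.* n) ⟨
    pow K x (m ℕ.* n)   ∎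

  pow-distrib-* : ∀ x y n → pow K (x * y) n ≈ pow K x n * pow K y n
  pow-distrib-* x y n = begin
    pow K (x * y) n       ≈⟨ pow≈^ (x * y) n ⟩
    (x * y) ^ n           ≈⟨ ^-distrib-* x y n ⟩
    x ^ n * y ^ n         ≈⟨ *-cong (pow≈^ x n) (pow≈^ y n) ⟨
    pow K x n * pow K y n ∎

  pow-zeroˡ : ∀ n → pow K 1# n ≈ 1#
  pow-zeroˡ zero    = refl
  pow-zeroˡ (suc n) = trans (*-identityˡ _) (pow-zeroˡ n)

module Characteristic {c ℓ : Level} (K : CommutativeRing c ℓ) where
  open import Data.Nat.Properties using (n∸n≡0)
  open import Data.Nat.Combinatorics using (_C_; nCn≡1)
  open import Data.Nat.Divisibility using (_∣_; divides)
  open import Data.Fin.Properties using (toℕ-fromℕ; toℕ-inject₁; toℕ<n)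
  open CommutativeRing K hiding (zero)
  open import Relation.Binary.Reasoning.Setoid setoid
  open import Algebra.Properties.Semiring.Exp semiring using (_^_)
  open import Algebra.Properties.Semiring.Mult semiring using (_×_; ×-congʳ; ×1-homo-*; ×-assoc-*)
  open import Algebra.Properties.Semiring.Sum semiring using (sum; sum-init-last; sum-cong-≋; sum-replicate-zero)
  open import Algebra.Properties.CommutativeSemiring.Binomial commutativeSemiring
    using (binomialTerm; theorem)
  open Powers K

  natK≈×1# : ∀ n → natK K n ≈ n × 1#
  natK≈×1# zero    = refl
  natK≈×1# (suc n) = +-congˡ (natK≈×1# n)

  p∣n⇒n×x≈0 : ∀ {p n} → natK K p ≈ 0# → p ∣ n → ∀ x → n × x ≈ 0#
  p∣n⇒n×x≈0 {p} char-p (divides d ≡.refl) x = begin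
    (d ℕ.* p) × x            ≈⟨ ×-congʳ (d ℕ.* p) (*-identityˡ x) ⟨
    (d ℕ.* p) × (1# * x)     ≈⟨ ×-assoc-* (d ℕ.* p) 1# x ⟨
    (d ℕ.* p) × 1# * x       ≈⟨ *-congʳ (×1-homo-* d p) ⟩
    (d × 1#) * (p × 1#) * x  ≈⟨ *-congʳ (*-congˡ (trans (sym (natK≈×1# p)) char-p)) ⟩
    (d × 1#) * 0# * x        ≈⟨ trans (*-congʳ (zeroʳ _)) (zeroˡ x) ⟩
    0#                       ∎

  pow-+-prime : ∀ {p} → Prime p → natK K p ≈ 0# → ∀ x y → pow K (x + y) p ≈ pow K x p + pow K y p
  pow-+-prime {suc n} p-prime char-p x y = begin
    pow K (x + y) p
      ≈⟨ trans (pow≈^ (x + y) p) (theorem p x y) ⟩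
    term zero + sum (λ k → term (suc k))
      ≈⟨ +-congˡ (sum-init-last (λ k → term (suc k))) ⟩
    term zero + (sum (λ k → term (suc (inject₁ k))) + term (suc (fromℕ n)))
      ≈⟨ +-cong first (+-cong (trans (sum-cong-≋ middle) (sum-replicate-zero n)) last) ⟩
    pow K y p + (0# + pow K x p)
      ≈⟨ trans (+-congˡ (+-identityˡ _)) (+-comm _ _) ⟩
    pow K x p + pow K y p ∎
    where
    p = suc n
    term = binomialTerm x y p
    first : term zero ≈ pow K y p
    first = trans (+-identityʳ _) (trans (*-identityˡ _) (sym (pow≈^ y p)))
    middle : ∀ k → term (suc (inject₁ k)) ≈ 0#
    middle k = p∣n⇒n×x≈0 char-p (p∣pCk p-prime (s≤s z≤n) k+1<p) _
      where
      k+1<p = s≤s (≡.subst (ℕ._< n) (≡.sym (toℕ-inject₁ k)) (toℕ<n k))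
    last : term (suc (fromℕ n)) ≈ pow K x p
    last = begin
      term (suc (fromℕ n))
        ≡⟨ ≡.cong (λ k → (p C k) × (x ^ k * y ^ (p ℕ.∸ k))) (≡.cong suc (toℕ-fromℕ n)) ⟩
      (p C p) × (x ^ p * y ^ (p ℕ.∸ p))
        ≡⟨ ≡.cong₂ (λ m k → m × (x ^ p * y ^ k)) (nCn≡1 p) (n∸n≡0 p) ⟩
      1 × (x ^ p * 1#)
        ≈⟨ trans (+-identityʳ _) (*-identityʳ _) ⟩
      x ^ p
        ≈⟨ pow≈^ x p ⟨
      pow K x p ∎

  pow-+-primePower : ∀ {p} → Prime p → natK K p ≈ 0# → ∀ n x y →
                     pow K (x + y) (p ℕ.^ n) ≈ pow K x (p ℕ.^ n) + pow K y (p ℕ.^ n)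
  pow-+-primePower _ _ zero x y =
    trans (*-identityʳ _) (sym (+-cong (*-identityʳ x) (*-identityʳ y)))
  pow-+-primePower {p} p-prime char-p (suc n) x y = begin
    pow K (x + y) (p ℕ.* p ℕ.^ n)                 ≈⟨ pow-assocʳ (x + y) p (p ℕ.^ n) ⟨
    pow K (pow K (x + y) p) (p ℕ.^ n)             ≈⟨ pow-congˡ (p ℕ.^ n) (pow-+-prime p-prime char-p x y) ⟩
    pow K (pow K x p + pow K y p) (p ℕ.^ n)       ≈⟨ pow-+-primePower p-prime char-p n _ _ ⟩
    pow K (pow K x p) (p ℕ.^ n) + pow K (pow K y p) (p ℕ.^ n)
      ≈⟨ +-cong (pow-assocʳ x p (p ℕ.^ n)) (pow-assocʳ y p (p ℕ.^ n)) ⟩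
    pow K x (p ℕ.* p ℕ.^ n) + pow K y (p ℕ.* p ℕ.^ n) ∎

module FiniteSums {c ℓ : Level} (K : CommutativeRing c ℓ) where
  open CommutativeRing K hiding (zero)
  open import Relation.Binary.Reasoning.Setoid setoid
  open import Algebra.Properties.Semiring.Sum semiring using (sum; sum-init-last)
  open import Algebra.Properties.CommutativeSemigroup *-commutativeSemigroup
    using () renaming (x∙yz≈y∙xz to x*yz≈y*xz)

  sumFin≡sum : ∀ t f → sumFin K t f ≡ sum f
  sumFin≡sum zero    f = ≡.refl
  sumFin≡sum (suc t) f = ≡.cong (f zero +_) (sumFin≡sum t (λ i → f (suc i)))

  sumFin-init-last : ∀ t f → sumFin K (suc t) f ≈ sumFin K t (λ i → f (inject₁ i)) + f (fromℕ t)
  sumFin-init-last t f = begin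
    sumFin K (suc t) f                       ≡⟨ sumFin≡sum (suc t) f ⟩
    sum f                                    ≈⟨ sum-init-last f ⟩
    sum (λ i → f (inject₁ i)) + f (fromℕ t)  ≡⟨ ≡.cong (_+ f (fromℕ t)) (sumFin≡sum t _) ⟨
    sumFin K t (λ i → f (inject₁ i)) + f (fromℕ t) ∎

  sumFin-cong : ∀ t {f g} → (∀ i → f i ≈ g i) → sumFin K t f ≈ sumFin K t g
  sumFin-cong zero    f≈g = refl
  sumFin-cong (suc t) f≈g = +-cong (f≈g zero) (sumFin-cong t (λ i → f≈g (suc i)))

  linComb-congʳ : ∀ t cs {us vs} → (∀ i → us i ≈ vs i) → linComb K t cs us ≈ linComb K t cs vs
  linComb-congʳ t cs us≈vs = sumFin-cong t (λ i → *-congˡ (us≈vs i))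

  linComb-zeroˡ : ∀ t {cs} us → (∀ i → cs i ≈ 0#) → linComb K t cs us ≈ 0#
  linComb-zeroˡ zero    us cs≈0 = refl
  linComb-zeroˡ (suc t) us cs≈0 = trans
    (+-cong (trans (*-congʳ (cs≈0 zero)) (zeroˡ _))
            (linComb-zeroˡ t (λ i → us (suc i)) (λ i → cs≈0 (suc i))))
    (+-identityʳ 0#)

  linComb-zeroʳ : ∀ t cs {us} → (∀ i → us i ≈ 0#) → linComb K t cs us ≈ 0#
  linComb-zeroʳ zero    cs us≈0 = refl
  linComb-zeroʳ (suc t) cs us≈0 = trans
    (+-cong (trans (*-congˡ (us≈0 zero)) (zeroʳ _))
            (linComb-zeroʳ t (λ i → cs (suc i)) (λ i → us≈0 (suc i))))
    (+-identityʳ 0#)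

  linComb-*ʳ : ∀ t cs us k → linComb K t cs (λ i → k * us i) ≈ k * linComb K t cs us
  linComb-*ʳ zero    cs us k = sym (zeroʳ k)
  linComb-*ʳ (suc t) cs us k = trans
    (+-cong (x*yz≈y*xz (cs zero) k (us zero)) (linComb-*ʳ t (λ i → cs (suc i)) (λ i → us (suc i)) k))
    (sym (distribˡ k _ _))

module FieldProperties {c ℓ : Level} (K : CommutativeRing c ℓ) (K-field : IsField K) where
  open CommutativeRing K hiding (zero)
  open import Relation.Binary.Reasoning.Setoid setoid
  open import Algebra.Properties.Ring ring using (-‿involutive; -0#≈0#)

  1#≉0# : 1# ≉ 0#
  1#≉0# = proj₁ K-field

  inv : ∀ x → x ≉ 0# → Carrier
  inv x x≉0 = proj₁ (proj₂ K-field x x≉0)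

  inv-inverseʳ : ∀ x (x≉0 : x ≉ 0#) → x * inv x x≉0 ≈ 1#
  inv-inverseʳ x x≉0 = proj₂ (proj₂ K-field x x≉0)

  inv-cancelˡ : ∀ x (x≉0 : x ≉ 0#) y → x * (inv x x≉0 * y) ≈ y
  inv-cancelˡ x x≉0 y = begin
    x * (inv x x≉0 * y) ≈⟨ *-assoc x _ y ⟨
    x * inv x x≉0 * y   ≈⟨ *-congʳ (inv-inverseʳ x x≉0) ⟩
    1# * y              ≈⟨ *-identityˡ y ⟩
    y                   ∎

  x≉0∧x*y≈0⇒y≈0 : ∀ {x y} → x ≉ 0# → x * y ≈ 0# → y ≈ 0#
  x≉0∧x*y≈0⇒y≈0 {x} {y} x≉0 x*y≈0 = begin
    y                   ≈⟨ inv-cancelˡ x x≉0 y ⟨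
    x * (inv x x≉0 * y) ≈⟨ *-congˡ (*-comm _ y) ⟩
    x * (y * inv x x≉0) ≈⟨ *-assoc x y _ ⟨
    x * y * inv x x≉0   ≈⟨ *-congʳ x*y≈0 ⟩
    0# * inv x x≉0      ≈⟨ zeroˡ _ ⟩
    0#                  ∎

  x≉0∧y≉0⇒x*y≉0 : ∀ {x y} → x ≉ 0# → y ≉ 0# → x * y ≉ 0#
  x≉0∧y≉0⇒x*y≉0 x≉0 y≉0 x*y≈0 = y≉0 (x≉0∧x*y≈0⇒y≈0 x≉0 x*y≈0)

  x≉0⇒pow≉0 : ∀ {x} n → x ≉ 0# → pow K x n ≉ 0#
  x≉0⇒pow≉0 zero    x≉0 = 1#≉0#
  x≉0⇒pow≉0 (suc n) x≉0 = x≉0∧y≉0⇒x*y≉0 x≉0 (x≉0⇒pow≉0 n x≉0)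

  x≉0⇒-x≉0 : ∀ {x} → x ≉ 0# → - x ≉ 0#
  x≉0⇒-x≉0 {x} x≉0 -x≈0 = x≉0 (trans (sym (-‿involutive x)) (trans (-‿cong -x≈0) -0#≈0#))

module LinearizedPolynomials
  {c ℓ : Level} (K : CommutativeRing c ℓ) (K-field : IsField K) {q q₀ : ℕ} (q≡1+q₀ : q ≡ suc q₀)
  (pow-q-+ : ∀ x y → CommutativeRing._≈_ K (pow K (CommutativeRing._+_ K x y) q)
                                           (CommutativeRing._+_ K (pow K x q) (pow K y q)))
  where

  open import Data.Nat.Properties using (m≤n⇒m≤1+n)
  open import Data.Fin.Properties using (toℕ-fromℕ; toℕ-inject₁)
  open import Function using (_∘_)
  open import Data.List using (List; []; _∷_; length; map; foldr)
  open import Data.List.Properties using (length-map)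
  open import Data.List.Relation.Unary.All using (All; []; _∷_)
  open import Data.Vec.Functional using () renaming (_∷_ to _∷ᶠ_)
  open import Data.Maybe using (nothing)
  open import Tactic.RingSolver.Core.AlmostCommutativeRing using (fromCommutativeRing)
  open CommutativeRing K hiding (zero)
  open import Relation.Binary.Reasoning.Setoid setoid
  open import Algebra.Properties.Ring ring
    using (-1*x≈-x; -‿distribˡ-*; -‿involutive; +-inverseˡ-unique)
  open import Algebra.Properties.CommutativeSemigroup +-commutativeSemigroup
    using () renaming (interchange to +-interchange)
  open import Algebra.Properties.CommutativeSemigroup *-commutativeSemigroup
    using () renaming (x∙yz≈y∙xz to x*yz≈y*xz)
  open Powers K
  open FiniteSums K
  open FieldProperties K K-field
  import Tactic.RingSolver.NonReflective (fromCommutativeRing K (λ _ → nothing)) as Solver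
  open Solver using (solve; _⊜_) renaming (_⊕_ to _:+_; _⊗_ to _:*_; ⊝_ to :-_)

  φ : Carrier → Carrier
  φ x = pow K x q

  φ-cong : ∀ {x y} → x ≈ y → φ x ≈ φ y
  φ-cong = pow-congˡ q

  φ≈x*pow-q₀ : ∀ x → φ x ≈ x * pow K x q₀
  φ≈x*pow-q₀ x = reflexive (≡.cong (pow K x) q≡1+q₀)

  φ-0# : φ 0# ≈ 0#
  φ-0# = trans (φ≈x*pow-q₀ 0#) (zeroˡ _)

  φ-1# : φ 1# ≈ 1#
  φ-1# = pow-zeroˡ q

  φ-* : ∀ x y → φ (x * y) ≈ φ x * φ y
  φ-* x y = pow-distrib-* x y q

  φ-‿ : ∀ x → φ (- x) ≈ - φ x
  φ-‿ x = +-inverseˡ-unique _ _ (begin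
    φ (- x) + φ x ≈⟨ pow-q-+ (- x) x ⟨
    φ (- x + x)   ≈⟨ φ-cong (-‿inverseˡ x) ⟩
    φ 0#          ≈⟨ φ-0# ⟩
    0#            ∎)

  φ-InFq-* : ∀ {λ′} x → InFq K q λ′ → φ (λ′ * x) ≈ λ′ * φ x
  φ-InFq-* x λ′∈Fq = trans (φ-* _ x) (*-congʳ λ′∈Fq)

  -- The q-polynomial l₀ x + l₁ x^q + l₂ x^(q²) + ⋯ is represented by the list [l₀, l₁, l₂, …].
  QPoly : Set c
  QPoly = List Carrier

  ⟦_⟧ : QPoly → Carrier → Carrier
  ⟦ []     ⟧ x = 0#
  ⟦ l ∷ ls ⟧ x = l * x + ⟦ ls ⟧ (φ x)

  coeff : QPoly → ℕ → Carrier
  coeff []       j       = 0#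
  coeff (l ∷ ls) zero    = l
  coeff (l ∷ ls) (suc j) = coeff ls j

  coeffSum : QPoly → Carrier
  coeffSum = foldr _+_ 0#

  infixl 6 _⊕_
  _⊕_ : QPoly → QPoly → QPoly
  []       ⊕ ms       = ms
  (l ∷ ls) ⊕ []       = l ∷ ls
  (l ∷ ls) ⊕ (m ∷ ms) = l + m ∷ ls ⊕ ms

  infixr 7 _·_
  _·_ : Carrier → QPoly → QPoly
  α · ls = map (α *_) ls

  φ∘_ : QPoly → QPoly
  φ∘ ls = 0# ∷ map φ ls

  compose : Carrier → Carrier → QPoly → QPoly
  compose α β ls = α · φ∘ ls ⊕ β · ls

  rescale : QPoly → Carrier → QPoly
  rescale []       v = []
  rescale (l ∷ ls) v = l * v ∷ rescale ls (φ v)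

  tailSums : QPoly → QPoly
  tailSums []       = []
  tailSums (l ∷ ls) = coeffSum (l ∷ ls) ∷ tailSums ls

  -- The Artin–Schreier map x ↦ x^q − x, written as a q-polynomial so that it is F_q-linear.
  ℘ : Carrier → Carrier
  ℘ = ⟦ - 1# ∷ 1# ∷ [] ⟧

  ⟦⟧-cong : ∀ ls {x y} → x ≈ y → ⟦ ls ⟧ x ≈ ⟦ ls ⟧ y
  ⟦⟧-cong []       x≈y = refl
  ⟦⟧-cong (l ∷ ls) x≈y = +-cong (*-congˡ x≈y) (⟦⟧-cong ls (φ-cong x≈y))

  ⟦⟧-0# : ∀ ls → ⟦ ls ⟧ 0# ≈ 0#
  ⟦⟧-0# []       = refl
  ⟦⟧-0# (l ∷ ls) = trans (+-cong (zeroʳ l) (trans (⟦⟧-cong ls φ-0#) (⟦⟧-0# ls))) (+-identityʳ 0#)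

  ⟦⟧-+ : ∀ ls x y → ⟦ ls ⟧ (x + y) ≈ ⟦ ls ⟧ x + ⟦ ls ⟧ y
  ⟦⟧-+ []       x y = sym (+-identityʳ 0#)
  ⟦⟧-+ (l ∷ ls) x y = begin
    l * (x + y) + ⟦ ls ⟧ (φ (x + y))
      ≈⟨ +-cong (distribˡ l x y) (trans (⟦⟧-cong ls (pow-q-+ x y)) (⟦⟧-+ ls (φ x) (φ y))) ⟩
    (l * x + l * y) + (⟦ ls ⟧ (φ x) + ⟦ ls ⟧ (φ y))
      ≈⟨ +-interchange _ _ _ _ ⟩
    (l * x + ⟦ ls ⟧ (φ x)) + (l * y + ⟦ ls ⟧ (φ y)) ∎

  ⟦⟧-InFq-* : ∀ ls {λ′} x → InFq K q λ′ → ⟦ ls ⟧ (λ′ * x) ≈ λ′ * ⟦ ls ⟧ x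
  ⟦⟧-InFq-* []       x λ′∈Fq = sym (zeroʳ _)
  ⟦⟧-InFq-* (l ∷ ls) {λ′} x λ′∈Fq = begin
    l * (λ′ * x) + ⟦ ls ⟧ (φ (λ′ * x))
      ≈⟨ +-cong (x*yz≈y*xz l λ′ x)
                (trans (⟦⟧-cong ls (φ-InFq-* x λ′∈Fq)) (⟦⟧-InFq-* ls (φ x) λ′∈Fq)) ⟩
    λ′ * (l * x) + λ′ * ⟦ ls ⟧ (φ x)
      ≈⟨ distribˡ λ′ _ _ ⟨
    λ′ * (l * x + ⟦ ls ⟧ (φ x)) ∎

  ⟦⟧-linComb : ∀ ls t cs us → (∀ i → InFq K q (cs i)) →
               ⟦ ls ⟧ (linComb K t cs us) ≈ linComb K t cs (λ i → ⟦ ls ⟧ (us i))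
  ⟦⟧-linComb ls zero    cs us cs∈Fq = ⟦⟧-0# ls
  ⟦⟧-linComb ls (suc t) cs us cs∈Fq = trans (⟦⟧-+ ls _ _)
    (+-cong (⟦⟧-InFq-* ls (us zero) (cs∈Fq zero))
            (⟦⟧-linComb ls t (λ i → cs (suc i)) (λ i → us (suc i)) (λ i → cs∈Fq (suc i))))

  ⟦⟧-⊕ : ∀ ls ms x → ⟦ ls ⊕ ms ⟧ x ≈ ⟦ ls ⟧ x + ⟦ ms ⟧ x
  ⟦⟧-⊕ []       ms       x = sym (+-identityˡ _)
  ⟦⟧-⊕ (l ∷ ls) []       x = sym (+-identityʳ _)
  ⟦⟧-⊕ (l ∷ ls) (m ∷ ms) x = begin
    (l + m) * x + ⟦ ls ⊕ ms ⟧ (φ x)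
      ≈⟨ +-cong (distribʳ x l m) (⟦⟧-⊕ ls ms (φ x)) ⟩
    (l * x + m * x) + (⟦ ls ⟧ (φ x) + ⟦ ms ⟧ (φ x))
      ≈⟨ +-interchange _ _ _ _ ⟩
    (l * x + ⟦ ls ⟧ (φ x)) + (m * x + ⟦ ms ⟧ (φ x)) ∎

  ⟦⟧-· : ∀ α ls x → ⟦ α · ls ⟧ x ≈ α * ⟦ ls ⟧ x
  ⟦⟧-· α []       x = sym (zeroʳ α)
  ⟦⟧-· α (l ∷ ls) x = trans (+-cong (*-assoc α l x) (⟦⟧-· α ls (φ x))) (sym (distribˡ α _ _))

  ⟦⟧-φ∘ : ∀ ls x → ⟦ φ∘ ls ⟧ x ≈ φ (⟦ ls ⟧ x)
  ⟦⟧-φ∘ ls x = trans (+-cong (zeroˡ x) (map-φ ls x)) (+-identityˡ _)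
    where
    map-φ : ∀ ls x → ⟦ map φ ls ⟧ (φ x) ≈ φ (⟦ ls ⟧ x)
    map-φ []       x = sym φ-0#
    map-φ (l ∷ ls) x = trans (+-cong (sym (φ-* l x)) (map-φ ls (φ x))) (sym (pow-q-+ _ _))

  ⟦⟧-compose : ∀ α β ls x → ⟦ compose α β ls ⟧ x ≈ α * φ (⟦ ls ⟧ x) + β * ⟦ ls ⟧ x
  ⟦⟧-compose α β ls x = begin
    ⟦ α · φ∘ ls ⊕ β · ls ⟧ x             ≈⟨ ⟦⟧-⊕ (α · φ∘ ls) (β · ls) x ⟩
    ⟦ α · φ∘ ls ⟧ x + ⟦ β · ls ⟧ x        ≈⟨ +-cong (⟦⟧-· α (φ∘ ls) x) (⟦⟧-· β ls x) ⟩
    α * ⟦ φ∘ ls ⟧ x + β * ⟦ ls ⟧ x        ≈⟨ +-congʳ (*-congˡ (⟦⟧-φ∘ ls x)) ⟩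
    α * φ (⟦ ls ⟧ x) + β * ⟦ ls ⟧ x       ∎

  ⟦⟧-rescale : ∀ ls v x → ⟦ rescale ls v ⟧ x ≈ ⟦ ls ⟧ (v * x)
  ⟦⟧-rescale []       v x = refl
  ⟦⟧-rescale (l ∷ ls) v x =
    +-cong (*-assoc l v x) (trans (⟦⟧-rescale ls (φ v) (φ x)) (⟦⟧-cong ls (sym (φ-* v x))))

  ⟦⟧-1# : ∀ ls → ⟦ ls ⟧ 1# ≈ coeffSum ls
  ⟦⟧-1# []       = refl
  ⟦⟧-1# (l ∷ ls) = +-cong (*-identityʳ l) (trans (⟦⟧-cong ls φ-1#) (⟦⟧-1# ls))

  ⟦⟧-allZero : ∀ {ls} → All (_≈ 0#) ls → ∀ x → ⟦ ls ⟧ x ≈ 0#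
  ⟦⟧-allZero []           x = refl
  ⟦⟧-allZero (l≈0 ∷ ls≈0) x =
    trans (+-cong (trans (*-congʳ l≈0) (zeroˡ x)) (⟦⟧-allZero ls≈0 (φ x))) (+-identityʳ 0#)

  ℘≈φ-id : ∀ x → ℘ x ≈ φ x - x
  ℘≈φ-id x = begin
    - 1# * x + (1# * φ x + 0#) ≈⟨ +-cong (-1*x≈-x x) (trans (+-identityʳ _) (*-identityˡ _)) ⟩
    - x + φ x                  ≈⟨ +-comm _ _ ⟩
    φ x - x                    ∎

  φ∘℘≈℘∘φ : ∀ x → φ (℘ x) ≈ ℘ (φ x)
  φ∘℘≈℘∘φ x = begin
    φ (℘ x)          ≈⟨ φ-cong (℘≈φ-id x) ⟩
    φ (φ x - x)      ≈⟨ pow-q-+ (φ x) (- x) ⟩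
    φ (φ x) + φ (- x) ≈⟨ +-congˡ (φ-‿ x) ⟩
    φ (φ x) - φ x    ≈⟨ ℘≈φ-id (φ x) ⟨
    ℘ (φ x)          ∎

  ℘≈0⇒InFq : ∀ {x} → ℘ x ≈ 0# → InFq K q x
  ℘≈0⇒InFq {x} ℘x≈0 = begin
    φ x         ≈⟨ +-inverseˡ-unique (φ x) (- x) (trans (sym (℘≈φ-id x)) ℘x≈0) ⟩
    - (- x)     ≈⟨ -‿involutive x ⟩
    x           ∎

  φ≈℘+id : ∀ x → φ x ≈ ℘ x + x
  φ≈℘+id x = begin
    φ x              ≈⟨ +-identityʳ (φ x) ⟨
    φ x + 0#         ≈⟨ +-congˡ (-‿inverseˡ x) ⟨
    φ x + (- x + x)  ≈⟨ +-assoc (φ x) (- x) x ⟨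
    φ x - x + x      ≈⟨ +-congʳ (℘≈φ-id x) ⟨
    ℘ x + x          ∎

  ⟦⟧∘φ : ∀ ls x → ⟦ ls ⟧ (φ x) ≈ coeffSum ls * x + ⟦ tailSums ls ⟧ (℘ x)
  ⟦⟧∘φ []       x = sym (trans (+-identityʳ _) (zeroˡ x))
  ⟦⟧∘φ (l ∷ ls) x = begin
    l * φ x + ⟦ ls ⟧ (φ (φ x))
      ≈⟨ +-congˡ (⟦⟧∘φ ls (φ x)) ⟩
    l * φ x + (S * φ x + E)
      ≈⟨ +-cong (*-congˡ (φ≈℘+id x)) (+-congʳ (*-congˡ (φ≈℘+id x))) ⟩
    l * (℘ x + x) + (S * (℘ x + x) + E)
      ≈⟨ solve 5 (λ l S p x E → (l :* (p :+ x) :+ (S :* (p :+ x) :+ E))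
                               ⊜ ((l :+ S) :* x :+ ((l :+ S) :* p :+ E)))
               refl l S (℘ x) x E ⟩
    (l + S) * x + ((l + S) * ℘ x + E)
      ≈⟨ +-congˡ (+-congˡ (⟦⟧-cong (tailSums ls) (φ∘℘≈℘∘φ x))) ⟨
    (l + S) * x + ((l + S) * ℘ x + ⟦ tailSums ls ⟧ (φ (℘ x))) ∎
    where
    S = coeffSum ls
    E = ⟦ tailSums ls ⟧ (℘ (φ x))

  ⟦⟧-℘-expansion : ∀ l ls x → ⟦ l ∷ ls ⟧ x ≈ ⟦ l ∷ ls ⟧ 1# * x + ⟦ tailSums ls ⟧ (℘ x)
  ⟦⟧-℘-expansion l ls x = begin
    l * x + ⟦ ls ⟧ (φ x)
      ≈⟨ +-congˡ (⟦⟧∘φ ls x) ⟩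
    l * x + (coeffSum ls * x + ⟦ tailSums ls ⟧ (℘ x))
      ≈⟨ +-assoc _ _ _ ⟨
    l * x + coeffSum ls * x + ⟦ tailSums ls ⟧ (℘ x)
      ≈⟨ +-congʳ (sym (distribʳ x l _)) ⟩
    coeffSum (l ∷ ls) * x + ⟦ tailSums ls ⟧ (℘ x)
      ≈⟨ +-congʳ (*-congʳ (⟦⟧-1# (l ∷ ls))) ⟨
    ⟦ l ∷ ls ⟧ 1# * x + ⟦ tailSums ls ⟧ (℘ x) ∎

  coeffSum-allZero : ∀ {ls} → All (_≈ 0#) ls → coeffSum ls ≈ 0#
  coeffSum-allZero []           = refl
  coeffSum-allZero (l≈0 ∷ ls≈0) = trans (+-cong l≈0 (coeffSum-allZero ls≈0)) (+-identityʳ 0#)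

  tailSums-allZero : ∀ ls → All (_≈ 0#) (tailSums ls) → All (_≈ 0#) ls
  tailSums-allZero []       []             = []
  tailSums-allZero (l ∷ ls) (sum≈0 ∷ ts≈0) = l≈0 ∷ ls≈0
    where
    ls≈0 = tailSums-allZero ls ts≈0
    l≈0 = trans (sym (+-identityʳ l)) (trans (+-congˡ (sym (coeffSum-allZero ls≈0))) sum≈0)

  rescale-allZero : ∀ ls {v} → v ≉ 0# → All (_≈ 0#) (rescale ls v) → All (_≈ 0#) ls
  rescale-allZero []       v≉0 []              = []
  rescale-allZero (l ∷ ls) v≉0 (lv≈0 ∷ rest≈0) =
    x≉0∧x*y≈0⇒y≈0 v≉0 (trans (*-comm _ l) lv≈0) ∷ rescale-allZero ls (x≉0⇒pow≉0 q v≉0) rest≈0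

  length-tailSums : ∀ ls → length (tailSums ls) ≡ length ls
  length-tailSums []       = ≡.refl
  length-tailSums (l ∷ ls) = ≡.cong suc (length-tailSums ls)

  length-rescale : ∀ ls v → length (rescale ls v) ≡ length ls
  length-rescale []       v = ≡.refl
  length-rescale (l ∷ ls) v = ≡.cong suc (length-rescale ls (φ v))

  independent⇒head≉0 : ∀ {m} (vs : Fin (suc m) → Carrier) → FqIndependent K q (suc m) vs → vs zero ≉ 0#
  independent⇒head≉0 {m} vs vs-indep v₀≈0 =
    1#≉0# (vs-indep (1# ∷ᶠ λ _ → 0#) ∈Fq combination≈0 zero)
    where
    ∈Fq : ∀ i → InFq K q ((1# ∷ᶠ λ _ → 0#) i)
    ∈Fq zero    = φ-1#
    ∈Fq (suc i) = φ-0#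
    combination≈0 : 1# * vs zero + linComb K m (λ _ → 0#) (λ i → vs (suc i)) ≈ 0#
    combination≈0 =
      trans (+-cong (trans (*-identityˡ _) v₀≈0) (linComb-zeroˡ m _ (λ _ → refl))) (+-identityʳ 0#)

  independent-tail : ∀ {m} (vs : Fin (suc m) → Carrier) →
                     FqIndependent K q (suc m) vs → FqIndependent K q m (λ i → vs (suc i))
  independent-tail vs vs-indep cs cs∈Fq combination≈0 i =
    vs-indep (0# ∷ᶠ cs) ∈Fq (trans (+-cong (zeroˡ _) combination≈0) (+-identityʳ 0#)) (suc i)
    where
    ∈Fq : ∀ i → InFq K q ((0# ∷ᶠ cs) i)
    ∈Fq zero    = φ-0#
    ∈Fq (suc i) = cs∈Fq i

  ℘-ratios : ∀ {m} (vs : Fin (suc m) → Carrier) → vs zero ≉ 0# → Fin m → Carrier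
  ℘-ratios vs v₀≉0 i = ℘ (inv (vs zero) v₀≉0 * vs (suc i))

  ℘-ratios-independent : ∀ {m} (vs : Fin (suc m) → Carrier) (vs-indep : FqIndependent K q (suc m) vs) →
                         FqIndependent K q m (℘-ratios vs (independent⇒head≉0 vs vs-indep))
  ℘-ratios-independent {m} vs vs-indep cs cs∈Fq combination≈0 i =
    vs-indep (- s ∷ᶠ cs) ∈Fq relation (suc i)
    where
    v₀ = vs zero
    v₀≉0 = independent⇒head≉0 vs vs-indep
    ws : Fin m → Carrier
    ws i = inv v₀ v₀≉0 * vs (suc i)
    s = linComb K m cs ws
    s∈Fq : InFq K q s
    s∈Fq = ℘≈0⇒InFq (begin
      ℘ s                                ≈⟨ ⟦⟧-linComb (- 1# ∷ 1# ∷ []) m cs ws cs∈Fq ⟩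
      linComb K m cs (λ i → ℘ (ws i))    ≈⟨ combination≈0 ⟩
      0#                                 ∎)
    ∈Fq : ∀ i → InFq K q ((- s ∷ᶠ cs) i)
    ∈Fq zero    = trans (φ-‿ s) (-‿cong s∈Fq)
    ∈Fq (suc i) = cs∈Fq i
    relation : - s * v₀ + linComb K m cs (λ i → vs (suc i)) ≈ 0#
    relation = begin
      - s * v₀ + linComb K m cs (λ i → vs (suc i))
        ≈⟨ +-congˡ (linComb-congʳ m cs (λ i → inv-cancelˡ v₀ v₀≉0 (vs (suc i)))) ⟨
      - s * v₀ + linComb K m cs (λ i → v₀ * ws i)
        ≈⟨ +-cong (sym (-‿distribˡ-* s v₀)) (trans (linComb-*ʳ m cs ws v₀) (*-comm v₀ s)) ⟩
      - (s * v₀) + s * v₀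
        ≈⟨ -‿inverseˡ _ ⟩
      0# ∎

  -- After rescaling by v₀ the polynomial vanishes at 1, so it factors through ℘, whose values at
  -- v₁/v₀, …, vₘ/v₀ are independent: induct on the number of vectors.
  vanishes-on-independent⇒allZero : ∀ m ls → length ls ≤ m → (vs : Fin m → Carrier) →
                                    FqIndependent K q m vs → (∀ i → ⟦ ls ⟧ (vs i) ≈ 0#) →
                                    All (_≈ 0#) ls
  vanishes-on-independent⇒allZero m       []       _           vs _        _        = []
  vanishes-on-independent⇒allZero (suc m) (l ∷ ls) (s≤s |ls|≤m) vs vs-indep ls-vanish =
    rescale-allZero (l ∷ ls) v₀≉0 (head≈0 ∷ tail≈0)
    where
    v₀ = vs zero
    v₀≉0 = independent⇒head≉0 vs vs-indep
    N = rescale (l ∷ ls) v₀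
    Q = tailSums (rescale ls (φ v₀))
    N-vanish : ∀ x → ⟦ l ∷ ls ⟧ (v₀ * x) ≈ 0# → ⟦ N ⟧ x ≈ 0#
    N-vanish x L[v₀x]≈0 = trans (⟦⟧-rescale (l ∷ ls) v₀ x) L[v₀x]≈0
    N[1]≈0 : ⟦ N ⟧ 1# ≈ 0#
    N[1]≈0 = N-vanish 1# (trans (⟦⟧-cong (l ∷ ls) (*-identityʳ v₀)) (ls-vanish zero))
    Q-vanish : ∀ i → ⟦ Q ⟧ (℘-ratios vs v₀≉0 i) ≈ 0#
    Q-vanish i = begin
      ⟦ Q ⟧ (℘ w)                     ≈⟨ +-identityˡ _ ⟨
      0# + ⟦ Q ⟧ (℘ w)                ≈⟨ +-congʳ (trans (*-congʳ N[1]≈0) (zeroˡ w)) ⟨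
      ⟦ N ⟧ 1# * w + ⟦ Q ⟧ (℘ w)      ≈⟨ ⟦⟧-℘-expansion (l * v₀) (rescale ls (φ v₀)) w ⟨
      ⟦ N ⟧ w                         ≈⟨ N-vanish w (trans (⟦⟧-cong (l ∷ ls) (inv-cancelˡ v₀ v₀≉0 _))
                                                            (ls-vanish (suc i))) ⟩
      0#                              ∎
      where w = inv v₀ v₀≉0 * vs (suc i)
    |Q|≤m : length Q ≤ m
    |Q|≤m = ≡.subst (_≤ m) (≡.sym |Q|≡|ls|) |ls|≤m
      where |Q|≡|ls| = ≡.trans (length-tailSums (rescale ls (φ v₀))) (length-rescale ls (φ v₀))
    tail≈0 : All (_≈ 0#) (rescale ls (φ v₀))
    tail≈0 = tailSums-allZero _
      (vanishes-on-independent⇒allZero m Q |Q|≤m _ (℘-ratios-independent vs vs-indep) Q-vanish)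
    head≈0 : l * v₀ ≈ 0#
    head≈0 = begin
      l * v₀                                     ≈⟨ *-identityʳ _ ⟨
      l * v₀ * 1#                                ≈⟨ +-identityʳ _ ⟨
      l * v₀ * 1# + 0#                           ≈⟨ +-congˡ (⟦⟧-allZero tail≈0 (φ 1#)) ⟨
      ⟦ N ⟧ 1#                                   ≈⟨ N[1]≈0 ⟩
      0#                                         ∎

  vanishes-on-span : ∀ ls t us → (∀ i → ⟦ ls ⟧ (us i) ≈ 0#) →
                     ∀ {x} → InFqSpan K q t us x → ⟦ ls ⟧ x ≈ 0#
  vanishes-on-span ls t us ls-vanish {x} (cs , cs∈Fq , x≈Σcsus) = begin
    ⟦ ls ⟧ x                                   ≈⟨ ⟦⟧-cong ls x≈Σcsus ⟩
    ⟦ ls ⟧ (linComb K t cs us)                 ≈⟨ ⟦⟧-linComb ls t cs us cs∈Fq ⟩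
    linComb K t cs (λ i → ⟦ ls ⟧ (us i))       ≈⟨ linComb-zeroʳ t cs ls-vanish ⟩
    0#                                         ∎

  coeff-⊕ : ∀ ls ms j → coeff (ls ⊕ ms) j ≈ coeff ls j + coeff ms j
  coeff-⊕ []       ms       j       = sym (+-identityˡ _)
  coeff-⊕ (l ∷ ls) []       zero    = sym (+-identityʳ _)
  coeff-⊕ (l ∷ ls) []       (suc j) = sym (+-identityʳ _)
  coeff-⊕ (l ∷ ls) (m ∷ ms) zero    = refl
  coeff-⊕ (l ∷ ls) (m ∷ ms) (suc j) = coeff-⊕ ls ms j

  coeff-map : ∀ f → f 0# ≈ 0# → ∀ ls j → coeff (map f ls) j ≈ f (coeff ls j)
  coeff-map f f0≈0 []       j       = sym f0≈0
  coeff-map f f0≈0 (l ∷ ls) zero    = refl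
  coeff-map f f0≈0 (l ∷ ls) (suc j) = coeff-map f f0≈0 ls j

  coeff-beyond-length : ∀ ls j → length ls ≤ j → coeff ls j ≡ 0#
  coeff-beyond-length []       j       _           = ≡.refl
  coeff-beyond-length (l ∷ ls) (suc j) (s≤s |ls|≤j) = coeff-beyond-length ls j |ls|≤j

  coeff-allZero : ∀ {ls} → All (_≈ 0#) ls → ∀ j → coeff ls j ≈ 0#
  coeff-allZero []           j       = refl
  coeff-allZero (l≈0 ∷ ls≈0) zero    = l≈0
  coeff-allZero (l≈0 ∷ ls≈0) (suc j) = coeff-allZero ls≈0 j

  coeff-compose-zero : ∀ α β ls → coeff (compose α β ls) 0 ≈ β * coeff ls 0
  coeff-compose-zero α β ls = begin
    coeff (α · φ∘ ls ⊕ β · ls) 0          ≈⟨ coeff-⊕ (α · φ∘ ls) (β · ls) 0 ⟩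
    α * 0# + coeff (β · ls) 0             ≈⟨ +-cong (zeroʳ α) (coeff-map (β *_) (zeroʳ β) ls 0) ⟩
    0# + β * coeff ls 0                   ≈⟨ +-identityˡ _ ⟩
    β * coeff ls 0                        ∎

  coeff-compose-suc : ∀ α β ls j →
                      coeff (compose α β ls) (suc j) ≈ α * φ (coeff ls j) + β * coeff ls (suc j)
  coeff-compose-suc α β ls j = begin
    coeff (α · φ∘ ls ⊕ β · ls) (suc j)
      ≈⟨ coeff-⊕ (α · φ∘ ls) (β · ls) (suc j) ⟩
    coeff (α · map φ ls) j + coeff (β · ls) (suc j)
      ≈⟨ +-cong (coeff-map (α *_) (zeroʳ α) (map φ ls) j) (coeff-map (β *_) (zeroʳ β) ls (suc j)) ⟩
    α * coeff (map φ ls) j + β * coeff ls (suc j)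
      ≈⟨ +-congʳ (*-congˡ (coeff-map φ φ-0# ls j)) ⟩
    α * φ (coeff ls j) + β * coeff ls (suc j) ∎

  length-⊕ : ∀ ls ms {n} → length ls ≤ n → length ms ≤ n → length (ls ⊕ ms) ≤ n
  length-⊕ []       ms       _           |ms|≤n      = |ms|≤n
  length-⊕ (l ∷ ls) []       |ls|≤n      _           = |ls|≤n
  length-⊕ (l ∷ ls) (m ∷ ms) (s≤s |ls|≤n) (s≤s |ms|≤n) = s≤s (length-⊕ ls ms |ls|≤n |ms|≤n)

  length-compose : ∀ α β ls {n} → length ls ≤ n → length (compose α β ls) ≤ suc n
  length-compose α β ls {n} |ls|≤n = length-⊕ (α · φ∘ ls) (β · ls)
    (≡.subst (_≤ suc n) (≡.sym (length-map (α *_) (φ∘ ls)))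
      (s≤s (≡.subst (_≤ n) (≡.sym (length-map φ ls)) |ls|≤n)))
    (≡.subst (_≤ suc n) (≡.sym (length-map (β *_) ls)) (m≤n⇒m≤1+n |ls|≤n))

  -- Composing with x^q − w^(q−1) x, where w = L(u₀), kills u₀ and keeps the roots of L.
  subspacePoly : ∀ m → (Fin m → Carrier) → QPoly
  subspacePoly zero    us = 1# ∷ []
  subspacePoly (suc m) us = compose 1# (- pow K w q₀) L
    where
    L = subspacePoly m (λ i → us (suc i))
    w = ⟦ L ⟧ (us zero)

  private
    module Step {m} (us : Fin (suc m) → Carrier) where
      L = subspacePoly m (λ i → us (suc i))
      w = ⟦ L ⟧ (us zero)
      γ = pow K w q₀

  subspacePoly-vanishes : ∀ m us i → ⟦ subspacePoly m us ⟧ (us i) ≈ 0#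
  subspacePoly-vanishes (suc m) us zero = begin
    ⟦ compose 1# (- γ) L ⟧ (us zero)  ≈⟨ ⟦⟧-compose 1# (- γ) L (us zero) ⟩
    1# * φ w + - γ * w
      ≈⟨ +-cong (trans (*-identityˡ _) (φ≈x*pow-q₀ w)) (sym (-‿distribˡ-* γ w)) ⟩
    w * γ + - (γ * w)                 ≈⟨ +-congˡ (-‿cong (*-comm γ w)) ⟩
    w * γ - w * γ                     ≈⟨ -‿inverseʳ _ ⟩
    0#                                ∎
    where open Step us
  subspacePoly-vanishes (suc m) us (suc i) = begin
    ⟦ compose 1# (- γ) L ⟧ (us (suc i))       ≈⟨ ⟦⟧-compose 1# (- γ) L (us (suc i)) ⟩
    1# * φ (⟦ L ⟧ (us (suc i))) + - γ * ⟦ L ⟧ (us (suc i))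
      ≈⟨ +-cong (*-congˡ (φ-cong L-vanishes)) (*-congˡ L-vanishes) ⟩
    1# * φ 0# + - γ * 0#                      ≈⟨ +-cong (trans (*-identityˡ _) φ-0#) (zeroʳ _) ⟩
    0# + 0#                                   ≈⟨ +-identityʳ 0# ⟩
    0#                                        ∎
    where
    open Step us
    L-vanishes = subspacePoly-vanishes m (λ i → us (suc i)) i

  length-subspacePoly : ∀ m us → length (subspacePoly m us) ≤ suc m
  length-subspacePoly zero    us = s≤s z≤n
  length-subspacePoly (suc m) us =
    length-compose 1# (- γ) L (length-subspacePoly m (λ i → us (suc i)))
    where open Step us

  subspacePoly-monic : ∀ m us → coeff (subspacePoly m us) m ≈ 1#
  subspacePoly-monic zero    us = refl
  subspacePoly-monic (suc m) us = begin
    coeff (compose 1# (- γ) L) (suc m)          ≈⟨ coeff-compose-suc 1# (- γ) L m ⟩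
    1# * φ (coeff L m) + - γ * coeff L (suc m)
      ≈⟨ +-cong (*-congˡ (φ-cong (subspacePoly-monic m _)))
                (*-congˡ (reflexive (coeff-beyond-length L (suc m) (length-subspacePoly m _)))) ⟩
    1# * φ 1# + - γ * 0#                        ≈⟨ +-cong (trans (*-identityˡ _) φ-1#) (zeroʳ _) ⟩
    1# + 0#                                     ≈⟨ +-identityʳ 1# ⟩
    1#                                          ∎
    where open Step us

  subspacePoly-coeff₀≉0 : ∀ m us → FqIndependent K q m us → coeff (subspacePoly m us) 0 ≉ 0#
  subspacePoly-coeff₀≉0 zero    us _        = 1#≉0#
  subspacePoly-coeff₀≉0 (suc m) us us-indep c₀≈0 =
    x≉0∧y≉0⇒x*y≉0 (x≉0⇒-x≉0 (x≉0⇒pow≉0 q₀ w≉0)) L-c₀≉0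
      (trans (sym (coeff-compose-zero 1# (- γ) L)) c₀≈0)
    where
    open Step us
    L-c₀≉0 = subspacePoly-coeff₀≉0 m _ (independent-tail us us-indep)
    w≉0 : w ≉ 0#
    w≉0 w≈0 = 1#≉0# (trans (sym (subspacePoly-monic m _))
      (coeff-allZero (vanishes-on-independent⇒allZero (suc m) L (length-subspacePoly m _) us us-indep
                                                      L-vanishes) m))
      where
      L-vanishes : ∀ i → ⟦ L ⟧ (us i) ≈ 0#
      L-vanishes zero    = w≈0
      L-vanishes (suc i) = subspacePoly-vanishes m _ i

  ⟦⟧≈linComb-monomials : ∀ ls n x → length ls ≤ n →
                         ⟦ ls ⟧ x ≈ linComb K n (λ j → coeff ls (toℕ j)) (λ j → pow K x (q ℕ.^ toℕ j))
  ⟦⟧≈linComb-monomials []       n       x _           = sym (linComb-zeroˡ n _ (λ _ → refl))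
  ⟦⟧≈linComb-monomials (l ∷ ls) (suc n) x (s≤s |ls|≤n) =
    +-cong (*-congˡ (sym (*-identityʳ x))) (begin
      ⟦ ls ⟧ (φ x)
        ≈⟨ ⟦⟧≈linComb-monomials ls n (φ x) |ls|≤n ⟩
      linComb K n (λ j → coeff ls (toℕ j)) (λ j → pow K (φ x) (q ℕ.^ toℕ j))
        ≈⟨ linComb-congʳ n _ (λ j → pow-assocʳ x q (q ℕ.^ toℕ j)) ⟩
      linComb K n (λ j → coeff ls (toℕ j)) (λ j → pow K x (q ℕ.^ suc (toℕ j))) ∎)

  fab≈⟦⟧ : ∀ t a f → length f ≤ suc (suc t) →
           coeff f 0 ≈ pow K a q → coeff f (suc t) ≈ pow K (- 1#) (suc t) * a →
           ∀ x → fab K q t a (λ i → coeff f (suc (toℕ i))) x ≈ ⟦ f ⟧ x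
  fab≈⟦⟧ t a f |f|≤t+2 f₀≈aᵠ fₜ₊₁≈±a x = begin
    (pow K a q * x + sumFin K t (λ i → term (suc (toℕ i))))
      + pow K (- 1#) (suc t) * a * monomial (suc t)
      ≈⟨ +-cong (+-cong (*-cong (sym f₀≈aᵠ) (sym (*-identityʳ x)))
                        (sumFin-cong t (λ i → reflexive (≡.cong (term ∘ suc) (≡.sym (toℕ-inject₁ i))))))
                (trans (*-congʳ (sym fₜ₊₁≈±a))
                       (reflexive (≡.cong (term ∘ suc) (≡.sym (toℕ-fromℕ t))))) ⟩
    (term 0 + sumFin K t (λ i → term′ (inject₁ i))) + term′ (fromℕ t)
      ≈⟨ +-assoc _ _ _ ⟩
    term 0 + (sumFin K t (λ i → term′ (inject₁ i)) + term′ (fromℕ t))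
      ≈⟨ +-congˡ (sumFin-init-last t term′) ⟨
    linComb K (suc (suc t)) (λ j → coeff f (toℕ j)) (λ j → monomial (toℕ j))
      ≈⟨ ⟦⟧≈linComb-monomials f (suc (suc t)) x |f|≤t+2 ⟨
    ⟦ f ⟧ x ∎
    where
    monomial : ℕ → Carrier
    monomial j = pow K x (q ℕ.^ j)
    term : ℕ → Carrier
    term j = coeff f j * monomial j
    term′ : Fin (suc t) → Carrier
    term′ i = term (suc (toℕ i))

  span⊆roots-of-fab : ∀ t a (us : Fin t → Carrier) → FqIndependent K q t us →
                      Σ (Fin t → Carrier) λ B → ∀ x → InFqSpan K q t us x → fab K q t a B x ≈ 0#
  span⊆roots-of-fab t a us us-indep = (λ i → coeff f (suc (toℕ i))) , f-vanishes
    where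
    L = subspacePoly t us
    L₀ = coeff L 0
    L₀≉0 = subspacePoly-coeff₀≉0 t us us-indep
    α = pow K (- 1#) (suc t) * a
    β = pow K a q * inv L₀ L₀≉0
    f = compose α β L
    f₀≈aᵠ : coeff f 0 ≈ pow K a q
    f₀≈aᵠ = begin
      coeff f 0                            ≈⟨ coeff-compose-zero α β L ⟩
      pow K a q * inv L₀ L₀≉0 * L₀         ≈⟨ *-assoc _ _ _ ⟩
      pow K a q * (inv L₀ L₀≉0 * L₀)       ≈⟨ *-congˡ (trans (*-comm _ _) (inv-inverseʳ L₀ L₀≉0)) ⟩
      pow K a q * 1#                       ≈⟨ *-identityʳ _ ⟩
      pow K a q                            ∎
    fₜ₊₁≈α : coeff f (suc t) ≈ α
    fₜ₊₁≈α = begin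
      coeff f (suc t)
        ≈⟨ coeff-compose-suc α β L t ⟩
      α * φ (coeff L t) + β * coeff L (suc t)
        ≈⟨ +-cong (*-congˡ (trans (φ-cong (subspacePoly-monic t us)) φ-1#))
                  (*-congˡ (reflexive (coeff-beyond-length L (suc t) (length-subspacePoly t us)))) ⟩
      α * 1# + β * 0#
        ≈⟨ trans (+-cong (*-identityʳ α) (zeroʳ β)) (+-identityʳ α) ⟩
      α ∎
    f-vanishes : ∀ x → InFqSpan K q t us x → fab K q t a (λ i → coeff f (suc (toℕ i))) x ≈ 0#
    f-vanishes x x∈span = begin
      fab K q t a (λ i → coeff f (suc (toℕ i))) x
        ≈⟨ fab≈⟦⟧ t a f (length-compose α β L (length-subspacePoly t us)) f₀≈aᵠ fₜ₊₁≈α x ⟩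
      ⟦ f ⟧ x
        ≈⟨ ⟦⟧-compose α β L x ⟩
      α * φ (⟦ L ⟧ x) + β * ⟦ L ⟧ x
        ≈⟨ +-cong (*-congˡ (trans (φ-cong Lx≈0) φ-0#)) (*-congˡ Lx≈0) ⟩
      α * 0# + β * 0#
        ≈⟨ trans (+-cong (zeroʳ α) (zeroʳ β)) (+-identityʳ 0#) ⟩
      0# ∎
      where Lx≈0 = vanishes-on-span L t us (subspacePoly-vanishes t us) x∈span

lemma3p4 : ∀ {c ℓ u : Level} (K : CommutativeRing c ℓ) (q t : ℕ) → t ≥ 1 →
    IsAlgClosureOfFq K q →
    (a : CommutativeRing.Carrier K) → ¬ (CommutativeRing._≈_ K a (CommutativeRing.0# K)) →
    (U : CommutativeRing.Carrier K → Set u) → IsFqSubspace K q U → HasFqDim K q U t →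
    Σ (Fin t → CommutativeRing.Carrier K) λ B →
      ∀ x → U x → CommutativeRing._≈_ K (fab K q t a B x) (CommutativeRing.0# K)
lemma3p4 K .(suc p₋₁ ℕ.^ n) t _ (suc p₋₁ , n , p-prime , _ , ≡.refl , K-field , char-p , _ , _)
         a _ U _ (us , us-indep , U⇔span) =
  B , λ x x∈U → B-vanishes x (proj₁ (U⇔span x) x∈U)
  where
  open import Data.Nat.Properties using (suc-pred; m^n≢0)
  q≡1+q₀ = ≡.sym (suc-pred (suc p₋₁ ℕ.^ n) {{m^n≢0 (suc p₋₁) n}})
  open LinearizedPolynomials K K-field q≡1+q₀ (Characteristic.pow-+-primePower K p-prime char-p n)
  B = proj₁ (span⊆roots-of-fab t a us us-indep)
  B-vanishes = proj₂ (span⊆roots-of-fab t a us us-indep)
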